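{- Let $\mathfrak{M}=(W,1,\curlywedge,V)$ and $\mathfrak{M}'=(W',1',\curlywedge',V')$ be L$_1$-models, $w\in W$, $w'\in W'$. If there is an L$_1$-simulation $S$ from $\mathfrak{M}$ to $\mathfrak{M}'$ with $(w,w')\in S$, then every formula $\phi\in\mathcal{L}$ with $\mathfrak{M},w\Vdash\phi$ also satisfies $\mathfrak{M}',w'\Vdash\phi$.
   Context: $\mathcal{L}$ is generated by $\phi ::= p\mid\top\mid\bot\mid\phi\wedge\phi\mid\phi\vee\phi$, $p$ in a fixed set $\mathrm{Prop}$. A meet-semilattice $(W,1,\curlywedge)$ is a poset in which every finite subset has a meet; $\curlywedge$ binary meet, $1$ top, $w\preccurlyeq v$ iff $w\curlywedge v=w$. A filter is a $\preccurlyeq$-upward closed subset closed under finite meets. An L$_1$-model $(W,1,\curlywedge,V)$ is a meet-semilattice with $V(p)$ a filter for each $p\in\mathrm{Prop}$. Satisfaction: $w\Vdash p$ iff $w\in V(p)$; $w\Vdash\top$ always; $w\Vdash\bot$ iff $w=1$; $\wedge$ is interpreted classically; $w\Vdash\phi_1\vee\phi_2$ iff there are $u,v$ with $u\curlywedge v\preccurlyeq w$, $u\Vdash\phi_1$, $v\Vdash\phi_2$. An L$_1$-simulation from $\mathfrak{M}$ to $\mathfrak{M}'$ is $S\subseteq W\times W'$ such that for all $(w,w')\in S$: (S1) $w\in V(p)$ implies $w'\in V'(p)$ for all $p$; (S2) $w=1$ implies $w'=1'$; (S3) if $v\curlywedge u\preccurlyeq w$ then there exist $v',u'\in W'$ with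 $(v,v'),(u,u')\in S$ and $v'\curlywedge'u'\preccurlyeq' w'$. -}

module Defs where

open import Level using (Level; _⊔_; suc)
open import Relation.Binary.PropositionalEquality using (_≡_)
open import Data.Product using (Σ; _×_; ∃-syntax)
open import Data.Unit.Polymorphic using (⊤)

data Form {p : Level} (Prop : Set p) : Set p where
  var  : Prop → Form Prop
  ⊤ᶠ   : Form Prop
  ⊥ᶠ   : Form Prop
  _∧ᶠ_ : Form Prop → Form Prop → Form Prop
  _∨ᶠ_ : Form Prop → Form Prop → Form Prop

-- A meet-semilattice (W, 1, ⋏): every finite subset has a meet, i.e.
-- a binary meet (associative, commutative, idempotent) with a top 1.
-- The order is w ≼ v iff w ⋏ v = w.
record MeetSemilattice (a : Level) : Set (suc a) where
  field
    W     : Set a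
    one   : W
    _⋏_   : W → W → W
    assoc : ∀ x y z → (x ⋏ y) ⋏ z ≡ x ⋏ (y ⋏ z)
    comm  : ∀ x y → x ⋏ y ≡ y ⋏ x
    idem  : ∀ x → x ⋏ x ≡ x
    top   : ∀ x → x ⋏ one ≡ x

  _≼_ : W → W → Set a
  w ≼ v = w ⋏ v ≡ w

record IsFilter {a ℓ : Level} (L : MeetSemilattice a) (F : MeetSemilattice.W L → Set ℓ) : Set (a ⊔ ℓ) where
  open MeetSemilattice L
  field
    up      : ∀ {w v} → w ≼ v → F w → F v
    has-one : F one
    meet    : ∀ {w v} → F w → F v → F (w ⋏ v)

record L1Model {p : Level} (Prop : Set p) (a ℓ : Level) : Set (p ⊔ suc a ⊔ suc ℓ) where
  field
    lat    : MeetSemilattice a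
  open MeetSemilattice lat public
  field
    V      : Prop → W → Set ℓ
    V-filt : ∀ q → IsFilter lat (V q)

module _ {p a ℓ : Level} {Prop : Set p} (M : L1Model Prop a ℓ) where
  open L1Model M

  infix 4 _⊩_
  _⊩_ : W → Form Prop → Set (a ⊔ ℓ)
  w ⊩ var q     = Level.Lift a (V q w)
  w ⊩ ⊤ᶠ        = ⊤
  w ⊩ ⊥ᶠ        = Level.Lift ℓ (w ≡ one)
  w ⊩ (φ ∧ᶠ ψ)  = (w ⊩ φ) × (w ⊩ ψ)
  w ⊩ (φ ∨ᶠ ψ)  = Σ W λ u → Σ W λ v → ((u ⋏ v) ≼ w) × (u ⊩ φ) × (v ⊩ ψ)

record IsL1Simulation {p a ℓ a' ℓ' s : Level} {Prop : Set p}
    (M : L1Model Prop a ℓ) (M' : L1Model Prop a' ℓ')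
    (S : L1Model.W M → L1Model.W M' → Set s) : Set (p ⊔ a ⊔ ℓ ⊔ a' ⊔ ℓ' ⊔ s) where
  module M  = L1Model M
  module M' = L1Model M'
  field
    S1 : ∀ {w w'} → S w w' → ∀ q → M.V q w → M'.V q w'
    S2 : ∀ {w w'} → S w w' → w ≡ M.one → w' ≡ M'.one
    S3 : ∀ {w w'} → S w w' → ∀ v u → (v M.⋏ u) M.≼ w →
         Σ M'.W λ v' → Σ M'.W λ u' → S v v' × S u u' × ((v' M'.⋏ u') M'.≼ w')

module Submission where

open import Defs
open import Level using (Level; lift)
open import Data.Product using (Σ; _×_; _,_)

module _ {p a ℓ a' ℓ' s : Level} {Prop : Set p}
    {M : L1Model Prop a ℓ} {M' : L1Model Prop a' ℓ'}
    {S : L1Model.W M → L1Model.W M' → Set s} (sim : IsL1Simulation M M' S) where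
  open IsL1Simulation sim

  simulation-preserves-⊩ : ∀ {w w'} → S w w' → (φ : Form Prop) → _⊩_ M w φ → _⊩_ M' w' φ
  simulation-preserves-⊩ wSw' (var q)  (lift w∈Vq) = lift (S1 wSw' q w∈Vq)
  simulation-preserves-⊩ wSw' ⊤ᶠ       _           = _
  simulation-preserves-⊩ wSw' ⊥ᶠ       (lift w≡1)  = lift (S2 wSw' w≡1)
  simulation-preserves-⊩ wSw' (φ ∧ᶠ ψ) (w⊩φ , w⊩ψ) =
    simulation-preserves-⊩ wSw' φ w⊩φ , simulation-preserves-⊩ wSw' ψ w⊩ψ
  simulation-preserves-⊩ wSw' (φ ∨ᶠ ψ) (u , v , u⋏v≼w , u⊩φ , v⊩ψ)
    with S3 wSw' u v u⋏v≼w
  ... | u' , v' , uSu' , vSv' , u'⋏v'≼w' =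
    u' , v' , u'⋏v'≼w' , simulation-preserves-⊩ uSu' φ u⊩φ , simulation-preserves-⊩ vSv' ψ v⊩ψ

proposition4p5 : {p a ℓ a' ℓ' s : Level} {Prop : Set p}
    (M : L1Model Prop a ℓ) (M' : L1Model Prop a' ℓ')
    (w : L1Model.W M) (w' : L1Model.W M')
    → (Σ (L1Model.W M → L1Model.W M' → Set s) λ S → IsL1Simulation M M' S × S w w')
    → (φ : Form Prop) → _⊩_ M w φ → _⊩_ M' w' φ
proposition4p5 M M' w w' (S , sim , wSw') = simulation-preserves-⊩ sim wSw'
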